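{- (Message Meaning rule for shared keys.) For every context $\Gamma$ and all messages $m,k,i,j$: if $\Gamma\vdash K_i\,@key_k(i,j)\ \land\ [recv_i]\,@\{m\}_k$, then $\Gamma\vdash K_i\,[send_j]\,@m$.
   Context: Messages are generated by: $null(n)$ ($n$ in a fixed finite index set), $nonce(m)$, $key_k(i,j)$ (a ternary constructor applied to messages $k,i,j$), $\{m\}_k$ (encryption), $decr(m,k)$, and pairs $(m,m')$; agents are represented by messages. Programs: $skip$, $\alpha;\beta$, $\alpha\cup\beta$, $send_i$, $recv_i$ ($i$ a message). Formulas: atoms, $\bot$, $\varphi\to\psi$, $K_i\varphi$ ($i$ a message), $[\alpha]\varphi$, $@\mu$ ($\mu$ a message), $\varphi\land\psi$, $\varphi\lor\psi$. A context $\Gamma$ is a set of formulas. The relation $\Gamma\vdash\varphi$ is the least relation such that: $\Gamma\vdash\varphi$ for $\varphi\in\Gamma$; $\Gamma\vdash$ every instance of a propositional tautology (in particular $\Gamma\vdash\varphi\land\psi$ iff $\Gamma\vdash\varphi$ and $\Gamma\vdash\psi$); and $\Gamma\vdash$ each of the axioms: $(K_i\varphi\land K_i\psi)\to K_i(\varphi\land\psi)$; $K_i\varphi\to\varphi$; $K_i(\varphi\to\psi)\to(K_i\varphi\to K_i\psi)$; $[\alpha](\varphi\to\psi)\to([\alpha]\psi\to[\alpha]\psi)$; $[\alpha]\varphi\to\varphi$; $(@key_k(i,j)\land @\{m\}_k)\to[send_j]@m$; $[recv_i]@m\to K_i@m$; $[send_i]@m\to K_i@m$; $[recv_i]\varphi\to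 K_i\varphi$; $[send_i]\varphi\to K_i\varphi$; and it is closed under modus ponens (from $\Gamma\vdash\varphi\to\psi$ and $\Gamma\vdash\varphi$ infer $\Gamma\vdash\psi$), knowledge generalization (from $\Gamma\vdash\varphi$ infer $\Gamma\vdash K_i\varphi$) and program generalization (from $\Gamma\vdash\varphi$ infer $\Gamma\vdash[\alpha]\varphi$). -}

module Defs where

open import Data.Nat using (ℕ)
open import Data.Fin using (Fin)
open import Data.Bool using (Bool; true; false; _∧_; _∨_; not)
open import Relation.Binary.PropositionalEquality using (_≡_)

data Msg (N : ℕ) : Set where
  null  : Fin N → Msg N
  nonce : Msg N → Msg N
  key   : Msg N → Msg N → Msg N → Msg N     -- key k i j  =  key_k(i,j)
  enc   : Msg N → Msg N → Msg N             -- enc m k    =  {m}_k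
  decr  : Msg N → Msg N → Msg N
  pair  : Msg N → Msg N → Msg N

data Prog (N : ℕ) : Set where
  skip  : Prog N
  _⨾_   : Prog N → Prog N → Prog N
  _∪_   : Prog N → Prog N → Prog N
  send  : Msg N → Prog N
  recv  : Msg N → Prog N

data Form (N : ℕ) : Set where
  atom  : ℕ → Form N
  ⊥f    : Form N
  _⇒_   : Form N → Form N → Form N
  K     : Msg N → Form N → Form N
  box   : Prog N → Form N → Form N
  at    : Msg N → Form N
  _∧f_  : Form N → Form N → Form N
  _∨f_  : Form N → Form N → Form N

infixr 4 _⇒_
infixr 6 _∧f_
infixr 5 _∨f_

-- Propositional evaluation: formulas whose main connective is not
-- propositional (atoms, K, [α], @) are treated as propositional letters,
-- assigned truth values by an arbitrary valuation v.
evalP : ∀ {N} → (Form N → Bool) → Form N → Bool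
evalP v (atom p)  = v (atom p)
evalP v ⊥f        = false
evalP v (φ ⇒ ψ)   = not (evalP v φ) ∨ evalP v ψ
evalP v (K i φ)   = v (K i φ)
evalP v (box α φ) = v (box α φ)
evalP v (at μ)    = v (at μ)
evalP v (φ ∧f ψ)  = evalP v φ ∧ evalP v ψ
evalP v (φ ∨f ψ)  = evalP v φ ∨ evalP v ψ

Taut : ∀ {N} → Form N → Set
Taut φ = ∀ v → evalP v φ ≡ true

Context : ℕ → Set₁
Context N = Form N → Set

data _⊢_ {N : ℕ} (Γ : Context N) : Form N → Set where
  hyp     : ∀ {φ} → Γ φ → Γ ⊢ φ
  taut    : ∀ {φ} → Taut φ → Γ ⊢ φ
  ax-K∧   : ∀ i φ ψ → Γ ⊢ ((K i φ ∧f K i ψ) ⇒ K i (φ ∧f ψ))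
  ax-KT   : ∀ i φ → Γ ⊢ (K i φ ⇒ φ)
  ax-KK   : ∀ i φ ψ → Γ ⊢ (K i (φ ⇒ ψ) ⇒ (K i φ ⇒ K i ψ))
  ax-box  : ∀ α φ ψ → Γ ⊢ (box α (φ ⇒ ψ) ⇒ (box α ψ ⇒ box α ψ))
  ax-boxT : ∀ α φ → Γ ⊢ (box α φ ⇒ φ)
  ax-key  : ∀ k i j m → Γ ⊢ ((at (key k i j) ∧f at (enc m k)) ⇒ box (send j) (at m))
  ax-recvAt : ∀ i m → Γ ⊢ (box (recv i) (at m) ⇒ K i (at m))
  ax-sendAt : ∀ i m → Γ ⊢ (box (send i) (at m) ⇒ K i (at m))
  ax-recv : ∀ i φ → Γ ⊢ (box (recv i) φ ⇒ K i φ)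
  ax-send : ∀ i φ → Γ ⊢ (box (send i) φ ⇒ K i φ)
  mp      : ∀ {φ ψ} → Γ ⊢ (φ ⇒ ψ) → Γ ⊢ φ → Γ ⊢ ψ
  kgen    : ∀ {φ} i → Γ ⊢ φ → Γ ⊢ K i φ
  pgen    : ∀ {φ} α → Γ ⊢ φ → Γ ⊢ box α φ

{-# OPTIONS --safe #-}
module Submission where

open import Data.Nat using (ℕ)
open import Data.Bool using (true; false)
open import Relation.Binary.PropositionalEquality using (refl)
open import Defs

module _ {N : ℕ} {Γ : Context N} where

  ∧-elimˡ : ∀ {φ ψ} → Γ ⊢ (φ ∧f ψ) → Γ ⊢ φ
  ∧-elimˡ {φ} {ψ} = mp (taut tautology)
    where
    tautology : Taut ((φ ∧f ψ) ⇒ φ)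
    tautology v with evalP v φ | evalP v ψ
    ... | true  | true  = refl
    ... | true  | false = refl
    ... | false | true  = refl
    ... | false | false = refl

  ∧-elimʳ : ∀ {φ ψ} → Γ ⊢ (φ ∧f ψ) → Γ ⊢ ψ
  ∧-elimʳ {φ} {ψ} = mp (taut tautology)
    where
    tautology : Taut ((φ ∧f ψ) ⇒ ψ)
    tautology v with evalP v φ | evalP v ψ
    ... | true  | true  = refl
    ... | true  | false = refl
    ... | false | true  = refl
    ... | false | false = refl

  ∧-intro : ∀ {φ ψ} → Γ ⊢ φ → Γ ⊢ ψ → Γ ⊢ (φ ∧f ψ)
  ∧-intro {φ} {ψ} ⊢φ ⊢ψ = mp (mp (taut tautology) ⊢φ) ⊢ψ
    where
    tautology : Taut (φ ⇒ ψ ⇒ (φ ∧f ψ))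
    tautology v with evalP v φ | evalP v ψ
    ... | true  | true  = refl
    ... | true  | false = refl
    ... | false | true  = refl
    ... | false | false = refl

  K-∧-intro : ∀ {i φ ψ} → Γ ⊢ K i φ → Γ ⊢ K i ψ → Γ ⊢ K i (φ ∧f ψ)
  K-∧-intro {i} ⊢Kφ ⊢Kψ = mp (ax-K∧ i _ _) (∧-intro ⊢Kφ ⊢Kψ)

  K-mp : ∀ {i φ ψ} → Γ ⊢ K i (φ ⇒ ψ) → Γ ⊢ K i φ → Γ ⊢ K i ψ
  K-mp {i} ⊢K[φ⇒ψ] = mp (mp (ax-KK i _ _) ⊢K[φ⇒ψ])

  recv⇒K : ∀ {i φ} → Γ ⊢ box (recv i) φ → Γ ⊢ K i φ
  recv⇒K {i} = mp (ax-recv i _)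

mainTheorem2 : ∀ (N : ℕ) (Γ : Context N) (m k i j : Msg N)
    → Γ ⊢ (K i (at (key k i j)) ∧f box (recv i) (at (enc m k)))
    → Γ ⊢ K i (box (send j) (at m))
mainTheorem2 N Γ m k i j premise =
  K-mp (kgen i (ax-key k i j m))
       (K-∧-intro knowsKey knowsCiphertext)
  where
  knowsKey : Γ ⊢ K i (at (key k i j))
  knowsKey = ∧-elimˡ premise

  knowsCiphertext : Γ ⊢ K i (at (enc m k))
  knowsCiphertext = recv⇒K (∧-elimʳ premise)
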